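{- For all integers $n,m\geq 0$, \[ A_{n+m,m}(\mathbf{t})=\sum_{k=0}^{n}(-1)^{n-k}\binom{n}{k}t_1^{n-k+1}\mathcal{Y}_{m+k}(\mathbf{t}). \]
   Context: $t_1,t_2,\dots$ are indeterminates. For a set partition $\pi$ assign each block of size $j$ the weight $t_j$, and let $w(\pi)$ be the product of its block weights. $\mathcal{Y}_n(\mathbf{t})$ is the sum of $w(\pi)$ over all partitions $\pi$ of $[n]=\{1,\dots,n\}$ ($\mathcal{Y}_0=1$). For $0\le k\le n$, $A_{n,k}(\mathbf{t})$ is the sum of $w(\pi)$ over all partitions of $[n+1]$ whose largest singleton block is $\{k+1\}$ (i.e. $\{k+1\}$ is a block and no $\{i\}$ with $i>k+1$ is a block). -}

module Defs where

open import Level using (Level)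
open import Data.Bool using (Bool; true; false; _∧_; _∨_; not; if_then_else_)
open import Data.Nat using (ℕ; zero; suc; _≡ᵇ_; _≤ᵇ_)
open import Data.Nat.Combinatorics using (_C_)
open import Data.Fin using (Fin; toℕ)
open import Data.Fin.Subset using (Subset)
open import Data.Vec using (Vec; []; _∷_; lookup)
open import Data.List using (List; []; _∷_; map; _++_; filterᵇ; length; allFin)
open import Data.Bool.ListAction using (all; any)
open import Algebra.Bundles using (CommutativeRing)

-- Finite combinatorics of set partitions of [n] ≅ Fin n
-- (element i : Fin n stands for the integer toℕ i + 1).

subsets : (n : ℕ) → List (Subset n)
subsets zero    = [] ∷ []
subsets (suc n) = map (false ∷_) (subsets n) ++ map (true ∷_) (subsets n)

sublists : ∀ {a} {A : Set a} → List A → List (List A)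
sublists []       = [] ∷ []
sublists (x ∷ xs) = map (x ∷_) (sublists xs) ++ sublists xs

size : ∀ {n} → Subset n → ℕ
size []          = zero
size (true ∷ p)  = suc (size p)
size (false ∷ p) = size p

member : ∀ {n} → Fin n → Subset n → Bool
member i p = lookup p i

nonempty : ∀ {n} → Subset n → Bool
nonempty p = not (size p ≡ᵇ zero)

isSetPartition : ∀ {n} → List (Subset n) → Bool
isSetPartition {n} bs =
  all nonempty bs ∧
  all (λ i → length (filterᵇ (member i) bs) ≡ᵇ 1) (allFin n)

-- all set partitions of Fin n, each represented (uniquely) as the list of
-- its blocks, taken as a sub-family of all subsets of Fin n
setPartitions : (n : ℕ) → List (List (Subset n))
setPartitions n = filterᵇ isSetPartition (sublists (subsets n))

-- the block {k} (k is the 0-based index, i.e. the integer k+1) is a block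
hasSingleton : ∀ {n} → ℕ → List (Subset n) → Bool
hasSingleton {n} k bs =
  any (λ b → (size b ≡ᵇ 1) ∧ any (λ i → member i b ∧ (toℕ i ≡ᵇ k)) (allFin n)) bs

noLargerSingleton : ∀ {n} → ℕ → List (Subset n) → Bool
noLargerSingleton {n} k bs =
  all (λ b → not (size b ≡ᵇ 1) ∨ all (λ i → not (member i b) ∨ (toℕ i ≤ᵇ k)) (allFin n)) bs

largestSingletonIs : ∀ {n} → ℕ → List (Subset n) → Bool
largestSingletonIs k bs = hasSingleton k bs ∧ noLargerSingleton k bs

-- Weighted sums in an arbitrary commutative ring (the indeterminates
-- t_1, t_2, ... are given by t : ℕ → Carrier; t 0 is never used).

module _ {c ℓ : Level} (R : CommutativeRing c ℓ) where
  open CommutativeRing R using (Carrier; _+_; _*_; -_; 0#; 1#)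

  sumR : List Carrier → Carrier
  sumR []       = 0#
  sumR (x ∷ xs) = x + sumR xs

  prodR : List Carrier → Carrier
  prodR []       = 1#
  prodR (x ∷ xs) = x * prodR xs

  powR : Carrier → ℕ → Carrier
  powR x zero    = 1#
  powR x (suc k) = x * powR x k

  natR : ℕ → Carrier
  natR zero    = 0#
  natR (suc k) = 1# + natR k

  signR : ℕ → Carrier
  signR zero    = 1#
  signR (suc k) = - signR k

  sumUpTo : ℕ → (ℕ → Carrier) → Carrier
  sumUpTo zero    f = f zero
  sumUpTo (suc n) f = sumUpTo n f + f (suc n)

  weight : ∀ {n} → (ℕ → Carrier) → List (Subset n) → Carrier
  weight t bs = prodR (map (λ b → t (size b)) bs)

  Y : (ℕ → Carrier) → ℕ → Carrier
  Y t n = sumR (map (weight t) (setPartitions n))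

  -- A_{n,k}(t) = Σ over partitions π of [n+1] whose largest singleton
  -- block is {k+1} of w(π)
  A : (ℕ → Carrier) → ℕ → ℕ → Carrier
  A t n k = sumR (map (weight t) (filterᵇ (largestSingletonIs k) (setPartitions (suc n))))

module Submission where

-- Points are numbered from 0 as in Defs, so [N] = {0,…,N−1} and A_{n,m}
-- sums over the partitions of [n+1] whose largest singleton block is {m}.
--
-- For T ⊆ [N] let Avoiding N T be the weighted sum over the partitions of [N]
-- with no singleton block inside T.  Then Avoiding N ∅ = 𝒴_N; Avoiding N T
-- only depends on |T| (adjacent transpositions of [N] act on partitions);
-- and splitting off the partitions having {0} as a block gives
-- Avoiding (N+1) ({0} ∪ T′) = Avoiding (N+1) T′ − t₁·Avoiding N T, with T′
-- the shift of T.  By induction Avoiding N T = ((E − t₁)^{|T|} G)(0) for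
-- G(k) = 𝒴_{N−|T|+k}, E the shift of sequences.  A partition of [n+1] has
-- largest singleton block {m} iff it has no singleton block in {m+1,…} but
-- has one in {m,…}; so A_{n+m,m} is a difference of two avoiding sums, which
-- becomes t₁·((E − t₁)ⁿ G)(0) for G(k) = 𝒴_{m+k}, and the binomial expansion
-- of (E − t₁)ⁿ gives the formula.

open import Defs
open import Level using (Level)
open import Data.Nat using (ℕ; _+_; _∸_)
open import Data.Nat.Combinatorics using (_C_)
open import Algebra.Bundles using (CommutativeRing)
open CommutativeRing using (Carrier) renaming (_≈_ to _⊢_≈_; _*_ to _⊢_*_)

open import Data.Nat using (zero; suc; _≡ᵇ_; _≤ᵇ_; _≤_; z≤n)
open import Data.Nat.Combinatorics using (nCk+nC[k+1]≡[n+1]C[k+1])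
open import Data.Nat.Combinatorics.Specification using (k>n⇒nCk≡0)
open import Data.Bool using (Bool; true; false; _∧_; _∨_; not)
open import Data.Bool.ListAction using (all; any)
open import Data.Fin using (Fin; zero; suc)
open import Data.List using (List; []; _∷_; [_]; map; _++_; filterᵇ; length; tabulate; allFin)
open import Function using (_∘_; id)
import Data.List.Relation.Binary.Permutation.Propositional as ↭
open ↭ using (_↭_)
open import Relation.Binary.PropositionalEquality as ≡ using (_≡_)

module ListCounting where
  open ≡ using (refl; sym; trans; cong; cong₂; subst)
  open import Data.Bool.Properties using (∧-assoc; ∧-zeroʳ)
  import Data.Nat.Properties as ℕ

  count : ∀ {a} {A : Set a} → (A → Bool) → List A → ℕ
  count p xs = length (filterᵇ p xs)

  module _ {a} {A : Set a} where

    all-map : ∀ {b} {B : Set b} (p : B → Bool) (f : A → B) (xs : List A) →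
              all p (map f xs) ≡ all (p ∘ f) xs
    all-map p f []       = refl
    all-map p f (x ∷ xs) = cong (p (f x) ∧_) (all-map p f xs)

    all-++ : (p : A → Bool) (xs ys : List A) → all p (xs ++ ys) ≡ all p xs ∧ all p ys
    all-++ p []       ys = refl
    all-++ p (x ∷ xs) ys = trans (cong (p x ∧_) (all-++ p xs ys)) (sym (∧-assoc (p x) _ _))

    all-cong : {p q : A → Bool} (xs : List A) → (∀ x → p x ≡ q x) → all p xs ≡ all q xs
    all-cong []       e = refl
    all-cong (x ∷ xs) e = cong₂ _∧_ (e x) (all-cong xs e)

    all-true : {p : A → Bool} (xs : List A) → (∀ x → p x ≡ true) → all p xs ≡ true
    all-true []       e = refl
    all-true (x ∷ xs) e rewrite e x = all-true xs e

    all-∧ : (p q : A → Bool) (xs : List A) → all (λ x → p x ∧ q x) xs ≡ all p xs ∧ all q xs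
    all-∧ p q []       = refl
    all-∧ p q (x ∷ xs) = trans (cong ((p x ∧ q x) ∧_) (all-∧ p q xs)) (interchange (p x) (q x) _ _)
      where
      interchange : ∀ a b c d → (a ∧ b) ∧ (c ∧ d) ≡ (a ∧ c) ∧ (b ∧ d)
      interchange true  b true  d = refl
      interchange true  b false d = ∧-zeroʳ b
      interchange false b c     d = refl

    any-as-all : (p : A → Bool) (xs : List A) → any p xs ≡ not (all (not ∘ p) xs)
    any-as-all p []       = refl
    any-as-all p (x ∷ xs) = trans (cong (p x ∨_) (any-as-all p xs)) (deMorgan (p x) _)
      where
      deMorgan : ∀ a c → a ∨ not c ≡ not (not a ∧ c)
      deMorgan true  c = refl
      deMorgan false c = refl

    -- membership tests and counts are invariant under permuting the list;
    -- this makes them independent of the order in which blocks are listed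
    all-↭ : (p : A → Bool) {xs ys : List A} → xs ↭ ys → all p xs ≡ all p ys
    all-↭ p ↭.refl            = refl
    all-↭ p (↭.prep x q)      = cong (p x ∧_) (all-↭ p q)
    all-↭ p (↭.swap x y q)    = trans (exchange (p x) (p y) _) (cong (λ z → p y ∧ (p x ∧ z)) (all-↭ p q))
      where
      exchange : ∀ a b c → a ∧ (b ∧ c) ≡ b ∧ (a ∧ c)
      exchange true  b     c = refl
      exchange false true  c = refl
      exchange false false c = refl
    all-↭ p (↭.trans q r)     = trans (all-↭ p q) (all-↭ p r)

    count-cong : {p q : A → Bool} (xs : List A) → (∀ x → p x ≡ q x) → count p xs ≡ count q xs
    count-cong []       e = refl
    count-cong {p} {q} (x ∷ xs) e with p x | q x | e x
    ... | true  | true  | refl = cong suc (count-cong xs e)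
    ... | false | false | refl = count-cong xs e

    count-map : ∀ {b} {B : Set b} (p : B → Bool) (f : A → B) (xs : List A) →
                count p (map f xs) ≡ count (p ∘ f) xs
    count-map p f []       = refl
    count-map p f (x ∷ xs) with p (f x)
    ... | true  = cong suc (count-map p f xs)
    ... | false = count-map p f xs

    count-++ : (p : A → Bool) (xs ys : List A) → count p (xs ++ ys) ≡ count p xs + count p ys
    count-++ p []       ys = refl
    count-++ p (x ∷ xs) ys with p x
    ... | true  = cong suc (count-++ p xs ys)
    ... | false = count-++ p xs ys

    count-↭ : (p : A → Bool) {xs ys : List A} → xs ↭ ys → count p xs ≡ count p ys
    count-↭ p ↭.refl = refl
    count-↭ p (↭.prep x q) with p x
    ... | true  = cong suc (count-↭ p q)
    ... | false = count-↭ p q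
    count-↭ p {x ∷ y ∷ xs} {.y ∷ .x ∷ ys} (↭.swap x y q) = begin
      count p ([ x ] ++ [ y ] ++ xs)     ≡⟨ count-++ p [ x ] ([ y ] ++ xs) ⟩
      cx + count p ([ y ] ++ xs)         ≡⟨ cong (cx +_) (count-++ p [ y ] xs) ⟩
      cx + (cy + count p xs)             ≡⟨ +-exchange cx cy (count p xs) ⟩
      cy + (cx + count p xs)             ≡⟨ cong (λ k → cy + (cx + k)) (count-↭ p q) ⟩
      cy + (cx + count p ys)             ≡⟨ cong (cy +_) (count-++ p [ x ] ys) ⟨
      cy + count p ([ x ] ++ ys)         ≡⟨ count-++ p [ y ] ([ x ] ++ ys) ⟨
      count p ([ y ] ++ [ x ] ++ ys)     ∎
      where
      open ≡.≡-Reasoning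
      open import Algebra.Properties.CommutativeSemigroup ℕ.+-commutativeSemigroup
        using () renaming (x∙yz≈y∙xz to +-exchange)
      cx = count p [ x ]
      cy = count p [ y ]
    count-↭ p (↭.trans q r) = trans (count-↭ p q) (count-↭ p r)

    count-none : (p : A → Bool) (xs : List A) → (∀ x → p x ≡ false) → count p xs ≡ 0
    count-none p []       e = refl
    count-none p (x ∷ xs) e with p x | e x
    ... | false | refl = count-none p xs e

    count-all : (p : A → Bool) (xs : List A) → (∀ x → p x ≡ true) → count p xs ≡ length xs
    count-all p []       e = refl
    count-all p (x ∷ xs) e with p x | e x
    ... | true | refl = cong suc (count-all p xs e)

  all-tabulate-cong : ∀ {a b} {A : Set a} {B : Set b} {n} (p : A → Bool) (q : B → Bool)
    (f : Fin n → A) (g : Fin n → B) → (∀ i → p (f i) ≡ q (g i)) →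
    all p (tabulate f) ≡ all q (tabulate g)
  all-tabulate-cong {n = zero}  p q f g e = refl
  all-tabulate-cong {n = suc n} p q f g e =
    cong₂ _∧_ (e zero) (all-tabulate-cong p q (f ∘ suc) (g ∘ suc) (e ∘ suc))

  all-tabulate⁻ : ∀ {a} {A : Set a} {n} (p : A → Bool) (f : Fin n → A) →
                  all p (tabulate f) ≡ true → ∀ i → p (f i) ≡ true
  all-tabulate⁻ {n = suc n} p f h i with p (f zero) in eq
  all-tabulate⁻ {n = suc n} p f h zero    | true = eq
  all-tabulate⁻ {n = suc n} p f h (suc i) | true = all-tabulate⁻ p (f ∘ suc) h i
  all-tabulate⁻ {n = suc n} p f () i      | false

  all-tabulate⁺ : ∀ {a} {A : Set a} {n} (p : A → Bool) (f : Fin n → A) →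
                  (∀ i → p (f i) ≡ true) → all p (tabulate f) ≡ true
  all-tabulate⁺ {n = zero}  p f h = refl
  all-tabulate⁺ {n = suc n} p f h rewrite h zero = all-tabulate⁺ p (f ∘ suc) (h ∘ suc)

  all-allFin-involution : ∀ {n} (p : Fin n → Bool) (σ : Fin n → Fin n) → (∀ i → σ (σ i) ≡ i) →
    all (p ∘ σ) (allFin n) ≡ all p (allFin n)
  all-allFin-involution {n} p σ inv with all p (allFin n) in eq₁ | all (p ∘ σ) (allFin n) in eq₂
  ... | true  | true  = refl
  ... | false | false = refl
  ... | true  | false = trans (sym eq₂) (all-tabulate⁺ (p ∘ σ) id (λ i → all-tabulate⁻ p id eq₁ (σ i)))
  ... | false | true  = trans (sym (all-tabulate⁺ p id (λ i → subst (λ j → p j ≡ true) (inv i)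
                                                       (all-tabulate⁻ (p ∘ σ) id eq₂ (σ i))))) eq₁

-- Subsets of Fin n as Boolean vectors: intersection tests and the adjacent
-- transposition of coordinates j and j+1.  Every notion used to single out
-- partitions is invariant under such a transposition applied simultaneously
-- to all blocks, which is the symmetry behind the main argument.
module SubsetOps where
  import Data.Nat.Properties as ℕ
  open import Data.Product using (Σ; _×_; _,_)
  open ≡ using (refl; sym; trans; cong; cong₂)
  open ListCounting
  open import Data.Fin using (toℕ)
  open import Data.Fin.Subset using (Subset; ⊥; ⊤; _∪_)
  open import Data.Fin.Subset.Properties using (∪-identityʳ)
  open import Data.Nat using (s≤s; _<ᵇ_)
  open import Data.Vec using (Vec; []; _∷_; lookup)
  open import Data.Vec.Properties using (lookup-replicate)
  open import Data.Bool.Properties using (∧-zeroʳ; ∨-zeroʳ)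
  open import Data.List.Properties using (map-++; map-∘; ++-assoc)
  open import Data.List.Relation.Binary.Permutation.Propositional.Properties
    using (map⁺; ++⁺; ++⁺ˡ; shifts)

  meets : ∀ {n} → Subset n → Subset n → Bool
  meets []      []      = false
  meets (x ∷ b) (y ∷ T) = (x ∧ y) ∨ meets b T

  singletonIn : ∀ {n} → Subset n → Subset n → Bool
  singletonIn T b = (size b ≡ᵇ 1) ∧ meets b T

  avoids : ∀ {n} → Subset n → List (Subset n) → Bool
  avoids T π = all (not ∘ singletonIn T) π

  meets-⊥ʳ : ∀ {n} (b : Subset n) → meets b ⊥ ≡ false
  meets-⊥ʳ []      = refl
  meets-⊥ʳ (x ∷ b) rewrite ∧-zeroʳ x = meets-⊥ʳ b

  meets-⊥ˡ : ∀ {n} (T : Subset n) → meets ⊥ T ≡ false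
  meets-⊥ˡ []      = refl
  meets-⊥ˡ (x ∷ T) = meets-⊥ˡ T

  size-⊥ : ∀ n → size (⊥ {n}) ≡ 0
  size-⊥ zero    = refl
  size-⊥ (suc n) = size-⊥ n

  size≡0⇒⊥ : ∀ {n} (b : Subset n) → size b ≡ 0 → b ≡ ⊥
  size≡0⇒⊥ []          e = refl
  size≡0⇒⊥ (false ∷ b) e = cong (false ∷_) (size≡0⇒⊥ b e)
  size≡0⇒⊥ (true ∷ b)  ()

  avoids-⊥ : ∀ {n} (π : List (Subset n)) → avoids ⊥ π ≡ true
  avoids-⊥ π = all-true π (λ b → trans (cong (λ z → not ((size b ≡ᵇ 1) ∧ z)) (meets-⊥ʳ b))
                                        (cong not (∧-zeroʳ _)))

  meets-∪ : ∀ {n} (b T U : Subset n) → meets b (T ∪ U) ≡ meets b T ∨ meets b U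
  meets-∪ []      []      []      = refl
  meets-∪ (x ∷ b) (y ∷ T) (z ∷ U) = trans (cong ((x ∧ (y ∨ z)) ∨_) (meets-∪ b T U)) (regroup x y z _ _)
    where
    regroup : ∀ x y z P Q → (x ∧ (y ∨ z)) ∨ (P ∨ Q) ≡ ((x ∧ y) ∨ P) ∨ ((x ∧ z) ∨ Q)
    regroup false y     z     P Q = refl
    regroup true  true  z     P Q = refl
    regroup true  false true  P Q = sym (∨-zeroʳ P)
    regroup true  false false P Q = refl

  avoids-∪ : ∀ {n} (T U : Subset n) (π : List (Subset n)) → avoids (T ∪ U) π ≡ avoids T π ∧ avoids U π
  avoids-∪ T U π = trans (all-cong π (λ b → trans (cong (λ z → not ((size b ≡ᵇ 1) ∧ z)) (meets-∪ b T U))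
                                                  (deMorgan (size b ≡ᵇ 1) (meets b T) (meets b U))))
                         (all-∧ (not ∘ singletonIn T) (not ∘ singletonIn U) π)
    where
    deMorgan : ∀ s a b → not (s ∧ (a ∨ b)) ≡ not (s ∧ a) ∧ not (s ∧ b)
    deMorgan true  true  b = refl
    deMorgan true  false b = refl
    deMorgan false a     b = refl

  size≤ : ∀ {n} (T : Subset n) → size T ≤ n
  size≤ []          = z≤n
  size≤ (true ∷ T)  = s≤s (size≤ T)
  size≤ (false ∷ T) = ℕ.m≤n⇒m≤1+n (size≤ T)

  meets-as-all : ∀ {n} (b T : Subset n) → meets b T ≡ not (all (λ i → not (lookup b i ∧ lookup T i)) (allFin n))
  meets-as-all []      []      = refl
  meets-as-all (x ∷ b) (y ∷ T) = trans (cong ((x ∧ y) ∨_) (meets-as-all b T))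
    (trans (deMorgan (x ∧ y) _) (cong (λ z → not (not (x ∧ y) ∧ z))
           (all-tabulate-cong (λ i → not (lookup b i ∧ lookup T i))
                              (λ i → not (lookup (x ∷ b) i ∧ lookup (y ∷ T) i)) id suc (λ i → refl))))
    where
    deMorgan : ∀ a c → a ∨ not c ≡ not (not a ∧ c)
    deMorgan true  c = refl
    deMorgan false c = refl

  above : ℕ → (L : ℕ) → Subset L
  above zero    L       = ⊤
  above (suc m) zero    = []
  above (suc m) (suc L) = false ∷ above m L

  single : ℕ → (L : ℕ) → Subset L
  single m       zero    = []
  single zero    (suc L) = true ∷ ⊥
  single (suc m) (suc L) = false ∷ single m L

  above-split : ∀ m L → above m L ≡ above (suc m) L ∪ single m L
  above-split zero    zero    = refl
  above-split zero    (suc L) = cong (true ∷_) (sym (∪-identityʳ ⊤))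
  above-split (suc m) zero    = refl
  above-split (suc m) (suc L) = cong (false ∷_) (above-split m L)

  size-above : ∀ m L → size (above m L) ≡ L ∸ m
  size-above zero    L       = size-⊤ L
    where
    size-⊤ : ∀ L → size (⊤ {L}) ≡ L
    size-⊤ zero    = refl
    size-⊤ (suc L) = cong suc (size-⊤ L)
  size-above (suc m) zero    = refl
  size-above (suc m) (suc L) = size-above m L

  lookup-above : ∀ m L (i : Fin L) → lookup (above (suc m) L) i ≡ not (toℕ i ≤ᵇ m)
  lookup-above m       (suc L) zero    = refl
  lookup-above zero    (suc L) (suc i) = lookup-replicate i true
  lookup-above (suc m) (suc L) (suc i) = trans (lookup-above m L i) (cong not (sym (<ᵇ-suc (toℕ i) m)))
    where
    <ᵇ-suc : ∀ a b → (a <ᵇ suc b) ≡ (a ≤ᵇ b)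
    <ᵇ-suc zero    b = refl
    <ᵇ-suc (suc a) b = refl

  lookup-single : ∀ m L (i : Fin L) → lookup (single m L) i ≡ (toℕ i ≡ᵇ m)
  lookup-single zero    (suc L) zero    = refl
  lookup-single zero    (suc L) (suc i) = lookup-replicate i false
  lookup-single (suc m) (suc L) zero    = refl
  lookup-single (suc m) (suc L) (suc i) = lookup-single m L i

  swap : ∀ {a} {A : Set a} {n} → ℕ → Vec A n → Vec A n
  swap zero    []          = []
  swap zero    (a ∷ [])    = a ∷ []
  swap zero    (a ∷ b ∷ v) = b ∷ a ∷ v
  swap (suc j) []          = []
  swap (suc j) (a ∷ v)     = a ∷ swap j v

  swapᶠ : ∀ {n} → ℕ → Fin n → Fin n
  swapᶠ {suc zero}    zero    zero          = zero
  swapᶠ {suc (suc n)} zero    zero          = suc zero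
  swapᶠ {suc (suc n)} zero    (suc zero)    = zero
  swapᶠ {suc (suc n)} zero    (suc (suc i)) = suc (suc i)
  swapᶠ               (suc j) zero          = zero
  swapᶠ               (suc j) (suc i)       = suc (swapᶠ j i)

  lookup-swap : ∀ {a} {A : Set a} {n} j (v : Vec A n) (i : Fin n) →
                lookup (swap j v) i ≡ lookup v (swapᶠ j i)
  lookup-swap zero    (a ∷ [])    zero          = refl
  lookup-swap zero    (a ∷ b ∷ v) zero          = refl
  lookup-swap zero    (a ∷ b ∷ v) (suc zero)    = refl
  lookup-swap zero    (a ∷ b ∷ v) (suc (suc i)) = refl
  lookup-swap (suc j) (a ∷ v)     zero          = refl
  lookup-swap (suc j) (a ∷ v)     (suc i)       = lookup-swap j v i

  swapᶠ-involutive : ∀ {n} j (i : Fin n) → swapᶠ j (swapᶠ j i) ≡ i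
  swapᶠ-involutive {suc zero}    zero    zero          = refl
  swapᶠ-involutive {suc (suc n)} zero    zero          = refl
  swapᶠ-involutive {suc (suc n)} zero    (suc zero)    = refl
  swapᶠ-involutive {suc (suc n)} zero    (suc (suc i)) = refl
  swapᶠ-involutive               (suc j) zero          = refl
  swapᶠ-involutive               (suc j) (suc i)       = cong suc (swapᶠ-involutive j i)

  size-swap : ∀ {n} j (v : Subset n) → size (swap j v) ≡ size v
  size-swap zero    []              = refl
  size-swap zero    (a ∷ [])        = refl
  size-swap zero    (true ∷ true ∷ v)   = refl
  size-swap zero    (true ∷ false ∷ v)  = refl
  size-swap zero    (false ∷ true ∷ v)  = refl
  size-swap zero    (false ∷ false ∷ v) = refl
  size-swap (suc j) []              = refl
  size-swap (suc j) (true ∷ v)      = cong suc (size-swap j v)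
  size-swap (suc j) (false ∷ v)     = size-swap j v

  meets-swap : ∀ {n} j (b T : Subset n) → meets (swap j b) T ≡ meets b (swap j T)
  meets-swap zero    []          []          = refl
  meets-swap zero    (a ∷ [])    (x ∷ [])    = refl
  meets-swap zero    (a ∷ b ∷ v) (x ∷ y ∷ U) = exchange (b ∧ x) (a ∧ y) (meets v U)
    where
    exchange : ∀ a b c → a ∨ (b ∨ c) ≡ b ∨ (a ∨ c)
    exchange true  true  c = refl
    exchange true  false c = refl
    exchange false b     c = refl
  meets-swap (suc j) []          []          = refl
  meets-swap (suc j) (a ∷ v)     (x ∷ U)     = cong ((a ∧ x) ∨_) (meets-swap j v U)

  -- transposing coordinates permutes the list of all subsets: for j = 0 the
  -- four groups of subsets, sorted by their first two coordinates, are listed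
  -- as ff ft tf tt, and the transposition exchanges the groups ft and tf
  subsets-swap : ∀ j n → map (swap j) (subsets n) ↭ subsets n
  subsets-swap zero zero          = ↭.refl
  subsets-swap zero (suc zero)    = ↭.refl
  subsets-swap zero (suc (suc n)) = ↭.trans (↭.↭-reflexive swapped)
    (↭.trans (↭.↭-reflexive (++-assoc ff tf (ft ++ tt)))
    (↭.trans (++⁺ˡ ff (shifts tf ft {tt}))
             (↭.↭-reflexive (trans (sym (++-assoc ff ft (tf ++ tt))) (sym unswapped)))))
    where
    S  = subsets n
    ff = map (λ v → false ∷ false ∷ v) S
    ft = map (λ v → false ∷ true ∷ v) S
    tf = map (λ v → true ∷ false ∷ v) S
    tt = map (λ v → true ∷ true ∷ v) S
    unswapped : subsets (suc (suc n)) ≡ (ff ++ ft) ++ (tf ++ tt)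
    unswapped = cong₂ _++_
      (trans (map-++ (false ∷_) (map (false ∷_) S) (map (true ∷_) S)) (cong₂ _++_ (sym (map-∘ S)) (sym (map-∘ S))))
      (trans (map-++ (true ∷_) (map (false ∷_) S) (map (true ∷_) S)) (cong₂ _++_ (sym (map-∘ S)) (sym (map-∘ S))))
    swapped : map (swap zero) (subsets (suc (suc n))) ≡ (ff ++ tf) ++ (ft ++ tt)
    swapped = trans (cong (map (swap zero)) unswapped)
      (trans (map-++ (swap zero) (ff ++ ft) (tf ++ tt))
      (trans (cong₂ _++_ (map-++ (swap zero) ff ft) (map-++ (swap zero) tf tt))
             (cong₂ _++_ (cong₂ _++_ (sym (map-∘ S)) (sym (map-∘ S)))
                         (cong₂ _++_ (sym (map-∘ S)) (sym (map-∘ S))))))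
  subsets-swap (suc j) zero    = ↭.refl
  subsets-swap (suc j) (suc n) = ↭.trans (↭.↭-reflexive split)
      (++⁺ (map⁺ (false ∷_) (subsets-swap j n)) (map⁺ (true ∷_) (subsets-swap j n)))
    where
    S = subsets n
    split : map (swap (suc j)) (subsets (suc n)) ≡ map (false ∷_) (map (swap j) S) ++ map (true ∷_) (map (swap j) S)
    split = trans (map-++ (swap (suc j)) (map (false ∷_) S) (map (true ∷_) S))
                  (cong₂ _++_ (trans (sym (map-∘ S)) (map-∘ S)) (trans (sym (map-∘ S)) (map-∘ S)))

  isSetPartition-swap : ∀ {n} j (π : List (Subset n)) → isSetPartition (map (swap j) π) ≡ isSetPartition π
  isSetPartition-swap {n} j π = cong₂ _∧_
    (trans (all-map nonempty (swap j) π) (all-cong π (λ b → cong (λ z → not (z ≡ᵇ 0)) (size-swap j b))))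
    (trans (all-cong (allFin n) (λ i → cong (_≡ᵇ 1) (trans (count-map (member i) (swap j) π)
                                                        (count-cong π (λ b → lookup-swap j b i)))))
           (all-allFin-involution (λ i → count (member i) π ≡ᵇ 1) (swapᶠ j) (swapᶠ-involutive j)))

  avoids-swap : ∀ {n} j (T : Subset n) (π : List (Subset n)) → avoids T (map (swap j) π) ≡ avoids (swap j T) π
  avoids-swap j T π = trans (all-map _ (swap j) π)
    (all-cong π (λ b → cong₂ (λ u v → not ((u ≡ᵇ 1) ∧ v)) (size-swap j b) (meets-swap j b T)))

  isSetPartition-↭ : ∀ {n} {π π′ : List (Subset n)} → π ↭ π′ → isSetPartition π ≡ isSetPartition π′
  isSetPartition-↭ {n} p = cong₂ _∧_ (all-↭ nonempty p) (all-cong (allFin n) (λ i → cong (_≡ᵇ 1) (count-↭ (member i) p)))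

  data Swaps {n} : Subset n → Subset n → Set where
    done : ∀ {T} → Swaps T T
    step : ∀ {T U} j → Swaps (swap j T) U → Swaps T U

  Swaps-trans : ∀ {n} {T U V : Subset n} → Swaps T U → Swaps U V → Swaps T V
  Swaps-trans done       q = q
  Swaps-trans (step j p) q = step j (Swaps-trans p q)

  Swaps-∷ : ∀ {n} x {T U : Subset n} → Swaps T U → Swaps (x ∷ T) (x ∷ U)
  Swaps-∷ x done       = done
  Swaps-∷ x (step j p) = step (suc j) (Swaps-∷ x p)

  bubble : ∀ {n} (T : Subset (suc n)) s → size T ≡ suc s →
           Σ (Subset n) (λ T₀ → size T₀ ≡ s × Swaps T (true ∷ T₀))
  bubble (true ∷ T) s e = T , ℕ.suc-injective e , done
  bubble {zero}  (false ∷ []) s ()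
  bubble {suc n} (false ∷ T)  s e with bubble T s e
  ... | T₀ , e₀ , p = (false ∷ T₀) , e₀ , Swaps-trans (Swaps-∷ false p) (step zero done)

-- The sums defining
-- 𝒴 and A run over the list `sublists (subsets n)` of all families of
-- subsets, so besides the usual linearity laws we need how such sums split
-- along the recursive structure of `sublists`.
module RingSums {c ℓ : Level} (R : CommutativeRing c ℓ) where
  open CommutativeRing R hiding (Carrier; zero)
    renaming (_+_ to _⊕_; _*_ to _⊗_; -_ to ⊖_)
  open import Relation.Binary.Reasoning.Setoid setoid
  open import Algebra.Properties.Ring ring using (-‿+-comm; -0#≈0#)
  open import Algebra.Properties.CommutativeSemigroup +-commutativeSemigroup
    using () renaming (interchange to +-interchange)
  open import Algebra.Properties.CommutativeSemigroup *-commutativeSemigroup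
    using () renaming (x∙yz≈y∙xz to *-exchange)
  open import Data.List.Properties using (map-++; map-∘)
  import Data.Nat.Properties as ℕ

  K : Set c
  K = Carrier R

  ∑ : ∀ {a} {X : Set a} → List X → (X → K) → K
  ∑ xs f = sumR R (map f xs)

  module _ {a} {X : Set a} where

    ∑-++ : (xs ys : List X) (f : X → K) → ∑ (xs ++ ys) f ≈ ∑ xs f ⊕ ∑ ys f
    ∑-++ []       ys f = sym (+-identityˡ _)
    ∑-++ (x ∷ xs) ys f = trans (+-congˡ (∑-++ xs ys f)) (sym (+-assoc _ _ _))

    ∑-map : ∀ {b} {Z : Set b} (g : X → Z) (xs : List X) (f : Z → K) → ∑ (map g xs) f ≡ ∑ xs (f ∘ g)
    ∑-map g []       f = ≡.refl
    ∑-map g (x ∷ xs) f = ≡.cong (f (g x) ⊕_) (∑-map g xs f)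

    ∑-cong : (xs : List X) {f g : X → K} → (∀ x → f x ≈ g x) → ∑ xs f ≈ ∑ xs g
    ∑-cong []       e = refl
    ∑-cong (x ∷ xs) e = +-cong (e x) (∑-cong xs e)

    ∑-+ : (xs : List X) (f g : X → K) → ∑ xs (λ x → f x ⊕ g x) ≈ ∑ xs f ⊕ ∑ xs g
    ∑-+ []       f g = sym (+-identityˡ _)
    ∑-+ (x ∷ xs) f g = trans (+-congˡ (∑-+ xs f g)) (+-interchange _ _ _ _)

    ∑-neg : (xs : List X) (f : X → K) → ∑ xs (λ x → ⊖ f x) ≈ ⊖ ∑ xs f
    ∑-neg []       f = sym -0#≈0#
    ∑-neg (x ∷ xs) f = trans (+-congˡ (∑-neg xs f)) (-‿+-comm _ _)

    ∑-- : (xs : List X) (f g : X → K) → ∑ xs (λ x → f x - g x) ≈ ∑ xs f - ∑ xs g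
    ∑-- xs f g = trans (∑-+ xs f (λ x → ⊖ g x)) (+-congˡ (∑-neg xs g))

    ∑-*ˡ : (xs : List X) (k : K) (f : X → K) → ∑ xs (λ x → k ⊗ f x) ≈ k ⊗ ∑ xs f
    ∑-*ˡ []       k f = sym (zeroʳ k)
    ∑-*ˡ (x ∷ xs) k f = trans (+-congˡ (∑-*ˡ xs k f)) (sym (distribˡ k _ _))

    ∑-zero : (xs : List X) (f : X → K) → (∀ x → f x ≈ 0#) → ∑ xs f ≈ 0#
    ∑-zero []       f e = refl
    ∑-zero (x ∷ xs) f e = trans (+-cong (e x) (∑-zero xs f e)) (+-identityˡ _)

  𝟙 : Bool → K
  𝟙 true  = 1#
  𝟙 false = 0#

  ∑-filter : ∀ {a} {X : Set a} (p : X → Bool) (xs : List X) (f : X → K) →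
             ∑ (filterᵇ p xs) f ≈ ∑ xs (λ x → 𝟙 (p x) ⊗ f x)
  ∑-filter p []       f = refl
  ∑-filter p (x ∷ xs) f with p x
  ... | true  = +-cong (sym (*-identityˡ _)) (∑-filter p xs f)
  ... | false = trans (∑-filter p xs f) (trans (sym (+-identityˡ _)) (+-congʳ (sym (zeroˡ _))))

  𝟙-∧-not : ∀ a b → 𝟙 (a ∧ not b) ≈ 𝟙 a - 𝟙 (a ∧ b)
  𝟙-∧-not false b     = sym (trans (+-congˡ -0#≈0#) (+-identityʳ _))
  𝟙-∧-not true  false = sym (trans (+-congˡ -0#≈0#) (+-identityʳ _))
  𝟙-∧-not true  true  = sym (-‿inverseʳ _)

  -- products of lists are multiplicative over append and invariant under
  -- permutation (so the weight of a partition ignores the order of blocks)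
  prodR-++ : (xs ys : List K) → prodR R (xs ++ ys) ≈ prodR R xs ⊗ prodR R ys
  prodR-++ []       ys = sym (*-identityˡ _)
  prodR-++ (x ∷ xs) ys = trans (*-congˡ (prodR-++ xs ys)) (sym (*-assoc _ _ _))

  prodR-↭ : {xs ys : List K} → xs ↭ ys → prodR R xs ≈ prodR R ys
  prodR-↭ ↭.refl         = refl
  prodR-↭ (↭.prep x p)   = *-congˡ (prodR-↭ p)
  prodR-↭ (↭.swap x y p) = trans (*-exchange x y _) (*-congˡ (*-congˡ (prodR-↭ p)))
  prodR-↭ (↭.trans p q)  = trans (prodR-↭ p) (prodR-↭ q)

  module _ {a} {X : Set a} where

    ∑-sublists-∷ : (x : X) (xs : List X) (h : List X → K) →
      ∑ (sublists (x ∷ xs)) h ≈ ∑ (sublists xs) (λ F → h (x ∷ F)) ⊕ ∑ (sublists xs) h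
    ∑-sublists-∷ x xs h = trans (∑-++ (map (x ∷_) (sublists xs)) (sublists xs) h)
                                (+-congʳ (reflexive (∑-map (x ∷_) (sublists xs) h)))

    ∑-sublists-++ : (xs ys : List X) (h : List X → K) →
      ∑ (sublists (xs ++ ys)) h ≈ ∑ (sublists xs) (λ F → ∑ (sublists ys) (λ G → h (F ++ G)))
    ∑-sublists-++ []       ys h = sym (+-identityʳ _)
    ∑-sublists-++ (x ∷ xs) ys h = begin
      ∑ (sublists (x ∷ xs ++ ys)) h
        ≈⟨ ∑-sublists-∷ x (xs ++ ys) h ⟩
      ∑ (sublists (xs ++ ys)) (λ F → h (x ∷ F)) ⊕ ∑ (sublists (xs ++ ys)) h
        ≈⟨ +-cong (∑-sublists-++ xs ys (λ F → h (x ∷ F))) (∑-sublists-++ xs ys h) ⟩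
      ∑ (sublists xs) (λ F → ∑ (sublists ys) (λ G → h (x ∷ F ++ G))) ⊕ ∑ (sublists xs) (λ F → ∑ (sublists ys) (λ G → h (F ++ G)))
        ≈⟨ ∑-sublists-∷ x xs _ ⟨
      ∑ (sublists (x ∷ xs)) (λ F → ∑ (sublists ys) (λ G → h (F ++ G))) ∎

    ∑-sublists-↭ : (h : List X → K) → (∀ {F F′} → F ↭ F′ → h F ≈ h F′) →
                   {xs ys : List X} → xs ↭ ys → ∑ (sublists xs) h ≈ ∑ (sublists ys) h
    ∑-sublists-↭ h inv ↭.refl = refl
    ∑-sublists-↭ h inv {x ∷ xs} {.x ∷ ys} (↭.prep x p) = begin
      ∑ (sublists (x ∷ xs)) h                                    ≈⟨ ∑-sublists-∷ x xs h ⟩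
      ∑ (sublists xs) (λ F → h (x ∷ F)) ⊕ ∑ (sublists xs) h
        ≈⟨ +-cong (∑-sublists-↭ (λ F → h (x ∷ F)) (inv ∘ ↭.prep x) p) (∑-sublists-↭ h inv p) ⟩
      ∑ (sublists ys) (λ F → h (x ∷ F)) ⊕ ∑ (sublists ys) h      ≈⟨ ∑-sublists-∷ x ys h ⟨
      ∑ (sublists (x ∷ ys)) h                                    ∎
    ∑-sublists-↭ h inv {x ∷ y ∷ xs} {.y ∷ .x ∷ ys} (↭.swap x y p) = begin
      ∑ (sublists (x ∷ y ∷ xs)) h
        ≈⟨ trans (∑-sublists-∷ x (y ∷ xs) h) (+-cong (∑-sublists-∷ y xs _) (∑-sublists-∷ y xs h)) ⟩
      (∑ (sublists xs) (λ F → h (x ∷ y ∷ F)) ⊕ ∑ (sublists xs) (λ F → h (x ∷ F))) ⊕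
        (∑ (sublists xs) (λ F → h (y ∷ F)) ⊕ ∑ (sublists xs) h)
        ≈⟨ +-cong (+-cong both (∑-sublists-↭ (λ F → h (x ∷ F)) (inv ∘ ↭.prep x) p))
                  (+-cong (∑-sublists-↭ (λ F → h (y ∷ F)) (inv ∘ ↭.prep y) p) (∑-sublists-↭ h inv p)) ⟩
      (∑ (sublists ys) (λ F → h (y ∷ x ∷ F)) ⊕ ∑ (sublists ys) (λ F → h (x ∷ F))) ⊕
        (∑ (sublists ys) (λ F → h (y ∷ F)) ⊕ ∑ (sublists ys) h)
        ≈⟨ +-interchange _ _ _ _ ⟩
      (∑ (sublists ys) (λ F → h (y ∷ x ∷ F)) ⊕ ∑ (sublists ys) (λ F → h (y ∷ F))) ⊕
        (∑ (sublists ys) (λ F → h (x ∷ F)) ⊕ ∑ (sublists ys) h)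
        ≈⟨ trans (∑-sublists-∷ y (x ∷ ys) h) (+-cong (∑-sublists-∷ x ys _) (∑-sublists-∷ x ys h)) ⟨
      ∑ (sublists (y ∷ x ∷ ys)) h ∎
      where
      both : ∑ (sublists xs) (λ F → h (x ∷ y ∷ F)) ≈ ∑ (sublists ys) (λ F → h (y ∷ x ∷ F))
      both = trans (∑-sublists-↭ (λ F → h (x ∷ y ∷ F)) (λ q → inv (↭.prep x (↭.prep y q))) p)
                   (∑-cong (sublists ys) (λ F → inv (↭.swap x y ↭.refl)))
    ∑-sublists-↭ h inv (↭.trans p q) = trans (∑-sublists-↭ h inv p) (∑-sublists-↭ h inv q)

    ∑-sublists-empty : (xs : List X) (h : List X → K) →
      (∀ G → (length G ≡ᵇ 0) ≡ false → h G ≈ 0#) → ∑ (sublists xs) h ≈ h []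
    ∑-sublists-empty []       h e = +-identityʳ _
    ∑-sublists-empty (x ∷ xs) h e = begin
      ∑ (sublists (x ∷ xs)) h                                 ≈⟨ ∑-sublists-∷ x xs h ⟩
      ∑ (sublists xs) (λ F → h (x ∷ F)) ⊕ ∑ (sublists xs) h
        ≈⟨ +-cong (∑-zero (sublists xs) _ (λ F → e (x ∷ F) ≡.refl)) (∑-sublists-empty xs h e) ⟩
      0# ⊕ h []                                               ≈⟨ +-identityˡ _ ⟩
      h []                                                    ∎

    ∑-sublists-singletons : (xs : List X) (h : List X → K) →
      (∀ G → (length G ≡ᵇ 1) ≡ false → h G ≈ 0#) → ∑ (sublists xs) h ≈ ∑ xs (λ x → h (x ∷ []))
    ∑-sublists-singletons []     h e = trans (+-identityʳ _) (e [] ≡.refl)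
    ∑-sublists-singletons (x ∷ xs) h e = trans (∑-sublists-∷ x xs h)
      (+-cong (∑-sublists-empty xs (λ F → h (x ∷ F)) (λ G → e (x ∷ G))) (∑-sublists-singletons xs h e))

  -- relabelling the elements commutes with taking sub-families (the middle
  -- step identifies map (g x ∷_) ∘ map (map g) with map (map g) ∘ map (x ∷_))
  sublists-map : ∀ {a b} {X : Set a} {Z : Set b} (g : X → Z) (xs : List X) →
                 sublists (map g xs) ≡ map (map g) (sublists xs)
  sublists-map g []       = ≡.refl
  sublists-map g (x ∷ xs) = ≡.trans (≡.cong (λ S → map (g x ∷_) S ++ S) (sublists-map g xs))
    (≡.trans (≡.cong (_++ map (map g) (sublists xs)) (≡.trans (≡.sym (map-∘ (sublists xs))) (map-∘ (sublists xs))))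
             (≡.sym (map-++ (map g) (map (x ∷_) (sublists xs)) (sublists xs))))

  ∑-sublists-map : ∀ {a b} {X : Set a} {Z : Set b} (g : X → Z) (xs : List X) (h : List Z → K) →
                   ∑ (sublists (map g xs)) h ≡ ∑ (sublists xs) (h ∘ map g)
  ∑-sublists-map g xs h = ≡.trans (≡.cong (λ L → ∑ L h) (sublists-map g xs)) (∑-map (map g) (sublists xs) h)

  sumUpTo-cong : ∀ s {f g : ℕ → K} → (∀ k → k ≤ s → f k ≈ g k) → sumUpTo R s f ≈ sumUpTo R s g
  sumUpTo-cong zero    e = e 0 z≤n
  sumUpTo-cong (suc s) e = +-cong (sumUpTo-cong s (λ k k≤s → e k (ℕ.m≤n⇒m≤1+n k≤s))) (e (suc s) ℕ.≤-refl)

  sumUpTo-shift : ∀ s (f : ℕ → K) → sumUpTo R (suc s) f ≈ f 0 ⊕ sumUpTo R s (f ∘ suc)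
  sumUpTo-shift zero    f = refl
  sumUpTo-shift (suc s) f = trans (+-congʳ (sumUpTo-shift s f)) (+-assoc _ _ _)

  sumUpTo-+ : ∀ s (f g : ℕ → K) → sumUpTo R s (λ k → f k ⊕ g k) ≈ sumUpTo R s f ⊕ sumUpTo R s g
  sumUpTo-+ zero    f g = refl
  sumUpTo-+ (suc s) f g = trans (+-congʳ (sumUpTo-+ s f g)) (+-interchange _ _ _ _)

  sumUpTo-*ˡ : ∀ s (a : K) (f : ℕ → K) → sumUpTo R s (λ k → a ⊗ f k) ≈ a ⊗ sumUpTo R s f
  sumUpTo-*ˡ zero    a f = refl
  sumUpTo-*ˡ (suc s) a f = trans (+-congʳ (sumUpTo-*ˡ s a f)) (sym (distribˡ _ _ _))

  sumUpTo-neg : ∀ s (f : ℕ → K) → sumUpTo R s (λ k → ⊖ f k) ≈ ⊖ sumUpTo R s f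
  sumUpTo-neg zero    f = refl
  sumUpTo-neg (suc s) f = trans (+-congʳ (sumUpTo-neg s f)) (-‿+-comm _ _)

-- The finite-difference operator Δₓ = E − x, where E shifts a sequence,
-- and its binomial expansion
--   ((E − x)ˢ F)(0) = Σ_{k=0}^{s} (−1)^{s−k} C(s,k) x^{s−k} F(k),
-- proved by induction on s with Pascal's rule.
module FiniteDifference {c ℓ : Level} (R : CommutativeRing c ℓ) where
  open CommutativeRing R hiding (Carrier; zero)
    renaming (_+_ to _⊕_; _*_ to _⊗_; -_ to ⊖_)
  open import Relation.Binary.Reasoning.Setoid setoid
  open import Algebra.Properties.Ring ring using (-‿distribˡ-*; -‿+-comm; -‿involutive)
  open import Algebra.Properties.CommutativeSemigroup +-commutativeSemigroup
    using () renaming (x∙yz≈y∙xz to +-exchange)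
  open import Algebra.Properties.CommutativeSemigroup *-commutativeSemigroup
    using () renaming (x∙yz≈y∙xz to *-exchange)
  open RingSums R using (K; sumUpTo-cong; sumUpTo-shift; sumUpTo-+; sumUpTo-*ˡ; sumUpTo-neg)
  import Data.Nat.Properties as ℕ

  -- ℕ → R is additive (needed to apply Pascal's rule inside R)
  natR-+ : ∀ a b → natR R (a + b) ≈ natR R a ⊕ natR R b
  natR-+ zero    b = sym (+-identityˡ _)
  natR-+ (suc a) b = trans (+-congˡ (natR-+ a b)) (sym (+-assoc _ _ _))

  module _ (x : K) where

    -- Δ s F = ((E − x)ˢ F)(0)
    Δ : ℕ → (ℕ → K) → K
    Δ zero    F = F 0
    Δ (suc s) F = Δ s (F ∘ suc) - x ⊗ Δ s F

    Δ-cong : ∀ s {F G : ℕ → K} → (∀ k → F k ≈ G k) → Δ s F ≈ Δ s G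
    Δ-cong zero    e = e 0
    Δ-cong (suc s) e = +-cong (Δ-cong s (e ∘ suc)) (-‿cong (*-congˡ (Δ-cong s e)))

    Δ-shift-difference : ∀ s F → Δ s (F ∘ suc) - Δ (suc s) F ≈ x ⊗ Δ s F
    Δ-shift-difference s F = begin
      a ⊕ ⊖ (a ⊕ ⊖ b)    ≈⟨ +-congˡ (-‿+-comm a (⊖ b)) ⟨
      a ⊕ (⊖ a ⊕ ⊖ ⊖ b)  ≈⟨ sym (+-assoc _ _ _) ⟩
      (a ⊕ ⊖ a) ⊕ ⊖ ⊖ b  ≈⟨ +-cong (-‿inverseʳ a) (-‿involutive b) ⟩
      0# ⊕ b             ≈⟨ +-identityˡ b ⟩
      b                  ∎
      where
      a = Δ s (F ∘ suc)
      b = x ⊗ Δ s F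

    coefficient : ℕ → ℕ → K
    coefficient s k = (signR R (s ∸ k) ⊗ natR R (s C k)) ⊗ powR R x (s ∸ k)

    term : ℕ → (ℕ → K) → ℕ → K
    term s F k = coefficient s k ⊗ F k

    -- the part of term (s+1) F (k+1) coming from C(s,k+1) in Pascal's rule
    pascalRest : ℕ → (ℕ → K) → ℕ → K
    pascalRest s F k = ((signR R (s ∸ k) ⊗ natR R (s C suc k)) ⊗ powR R x (s ∸ k)) ⊗ F (suc k)

    term-pascal : ∀ s F k → term (suc s) F (suc k) ≈ term s (F ∘ suc) k ⊕ pascalRest s F k
    term-pascal s F k = begin
      ((σ ⊗ natR R (suc s C suc k)) ⊗ p) ⊗ F (suc k)
        ≈⟨ *-congʳ (*-congʳ (*-congˡ (reflexive (≡.cong (natR R) (≡.sym (nCk+nC[k+1]≡[n+1]C[k+1] s k)))))) ⟩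
      ((σ ⊗ natR R (s C k + s C suc k)) ⊗ p) ⊗ F (suc k)
        ≈⟨ *-congʳ (*-congʳ (*-congˡ (natR-+ (s C k) (s C suc k)))) ⟩
      ((σ ⊗ (natR R (s C k) ⊕ natR R (s C suc k))) ⊗ p) ⊗ F (suc k)
        ≈⟨ *-congʳ (trans (*-congʳ (distribˡ _ _ _)) (distribʳ _ _ _)) ⟩
      ((σ ⊗ natR R (s C k)) ⊗ p ⊕ (σ ⊗ natR R (s C suc k)) ⊗ p) ⊗ F (suc k)
        ≈⟨ distribʳ _ _ _ ⟩
      term s (F ∘ suc) k ⊕ pascalRest s F k ∎
      where
      σ = signR R (s ∸ k)
      p = powR R x (s ∸ k)

    -- the sign (−1)^{j+1} = −(−1)^j absorbs the extra factor of x^{j+1}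
    flip-sign : ∀ σ ν p f → ((⊖ σ ⊗ ν) ⊗ (x ⊗ p)) ⊗ f ≈ ⊖ (x ⊗ (((σ ⊗ ν) ⊗ p) ⊗ f))
    flip-sign σ ν p f = begin
      ((⊖ σ ⊗ ν) ⊗ (x ⊗ p)) ⊗ f     ≈⟨ *-congʳ (*-congʳ (-‿distribˡ-* σ ν)) ⟨
      (⊖ (σ ⊗ ν) ⊗ (x ⊗ p)) ⊗ f     ≈⟨ *-congʳ (-‿distribˡ-* _ _) ⟨
      ⊖ ((σ ⊗ ν) ⊗ (x ⊗ p)) ⊗ f     ≈⟨ -‿distribˡ-* _ _ ⟨
      ⊖ (((σ ⊗ ν) ⊗ (x ⊗ p)) ⊗ f)   ≈⟨ -‿cong (*-congʳ (*-exchange _ _ _)) ⟩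
      ⊖ ((x ⊗ ((σ ⊗ ν) ⊗ p)) ⊗ f)   ≈⟨ -‿cong (*-assoc _ _ _) ⟩
      ⊖ (x ⊗ (((σ ⊗ ν) ⊗ p) ⊗ f))   ∎

    pascalRest-below : ∀ s F k → k ≤ s → pascalRest (suc s) F k ≈ ⊖ (x ⊗ term (suc s) F (suc k))
    pascalRest-below s F k k≤s rewrite ℕ.+-∸-assoc 1 k≤s = flip-sign _ _ _ _

    -- at the top index C(s,s+1) = 0
    pascalRest-top : ∀ s F → pascalRest s F s ≈ 0#
    pascalRest-top s F = begin
      ((signR R (s ∸ s) ⊗ natR R (s C suc s)) ⊗ p) ⊗ F (suc s)
        ≈⟨ *-congʳ (*-congʳ (*-congˡ (reflexive (≡.cong (natR R) (k>n⇒nCk≡0 (ℕ.n<1+n s)))))) ⟩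
      ((signR R (s ∸ s) ⊗ 0#) ⊗ p) ⊗ F (suc s)
        ≈⟨ trans (*-congʳ (trans (*-congʳ (zeroʳ _)) (zeroˡ _))) (zeroˡ _) ⟩
      0# ∎
      where p = powR R x (s ∸ s)

    term-zero : ∀ s F → term (suc s) F 0 ≈ ⊖ (x ⊗ term s F 0)
    term-zero s F = flip-sign _ _ _ _

    -- the terms of order s+1 not produced by E: they assemble to −x · (expansion of order s)
    pascalRest-sum : ∀ s F → term (suc s) F 0 ⊕ sumUpTo R s (pascalRest s F) ≈ ⊖ (x ⊗ sumUpTo R s (term s F))
    pascalRest-sum zero F = trans (+-cong (term-zero zero F) (pascalRest-top zero F)) (+-identityʳ _)
    pascalRest-sum (suc s) F = begin
      term (suc (suc s)) F 0 ⊕ (sumUpTo R s (pascalRest (suc s) F) ⊕ pascalRest (suc s) F (suc s))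
        ≈⟨ +-cong (term-zero (suc s) F)
                  (trans (+-cong (sumUpTo-cong s (pascalRest-below s F)) (pascalRest-top (suc s) F)) (+-identityʳ _)) ⟩
      ⊖ xterm 0 ⊕ sumUpTo R s (λ k → ⊖ xterm (suc k))  ≈⟨ +-congˡ (sumUpTo-neg s _) ⟩
      ⊖ xterm 0 ⊕ ⊖ sumUpTo R s (xterm ∘ suc)          ≈⟨ -‿+-comm _ _ ⟩
      ⊖ (xterm 0 ⊕ sumUpTo R s (xterm ∘ suc))          ≈⟨ -‿cong (sumUpTo-shift s xterm) ⟨
      ⊖ sumUpTo R (suc s) xterm                         ≈⟨ -‿cong (sumUpTo-*ˡ (suc s) x _) ⟩
      ⊖ (x ⊗ sumUpTo R (suc s) (term (suc s) F))        ∎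
      where
      xterm = λ k → x ⊗ term (suc s) F k

    powR-suc : ∀ j → powR R x (j + 1) ≈ x ⊗ powR R x j
    powR-suc zero    = refl
    powR-suc (suc j) = *-congˡ (powR-suc j)

    *-term : ∀ s F k → x ⊗ term s F k ≈ ((signR R (s ∸ k) ⊗ natR R (s C k)) ⊗ powR R x (s ∸ k + 1)) ⊗ F k
    *-term s F k = trans (sym (*-assoc _ _ _)) (*-congʳ (trans (*-exchange _ _ _) (*-congˡ (sym (powR-suc (s ∸ k))))))

    Δ-expansion : ∀ s F → Δ s F ≈ sumUpTo R s (term s F)
    Δ-expansion zero F = sym (trans (*-congʳ (trans (*-identityʳ _) (trans (*-identityˡ _) (+-identityʳ _))))
                                    (*-identityˡ _))
    Δ-expansion (suc s) F = begin
      Δ s (F ∘ suc) - x ⊗ Δ s F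
        ≈⟨ +-cong (Δ-expansion s (F ∘ suc)) (-‿cong (*-congˡ (Δ-expansion s F))) ⟩
      sumUpTo R s (term s (F ∘ suc)) ⊕ ⊖ (x ⊗ sumUpTo R s (term s F))
        ≈⟨ +-congˡ (pascalRest-sum s F) ⟨
      sumUpTo R s (term s (F ∘ suc)) ⊕ (term (suc s) F 0 ⊕ sumUpTo R s (pascalRest s F))
        ≈⟨ +-exchange _ _ _ ⟩
      term (suc s) F 0 ⊕ (sumUpTo R s (term s (F ∘ suc)) ⊕ sumUpTo R s (pascalRest s F))
        ≈⟨ +-congˡ (sumUpTo-+ s _ _) ⟨
      term (suc s) F 0 ⊕ sumUpTo R s (λ k → term s (F ∘ suc) k ⊕ pascalRest s F k)
        ≈⟨ +-congˡ (sumUpTo-cong s (λ k _ → term-pascal s F k)) ⟨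
      term (suc s) F 0 ⊕ sumUpTo R s (term (suc s) F ∘ suc)
        ≈⟨ sumUpTo-shift s _ ⟨
      sumUpTo R (suc s) (term (suc s) F) ∎

-- Avoiding N T, the weighted sum over partitions of [N] none of whose
-- singleton blocks lies in T, satisfies
--   (i)   Avoiding N ∅ = 𝒴_N;
--   (ii)  Avoiding N T depends only on |T| (it is invariant under
--         transposing adjacent coordinates of T and of all blocks);
--   (iii) Avoiding (N+1) ({0} ∪ T′) = Avoiding (N+1) T′ − t₁ · Avoiding N T
--         where T′ is T shifted by one: among the partitions avoiding T′,
--         those with {0} as a block are {0} adjoined to a partition of the
--         remaining N points avoiding T.
-- Hence Avoiding N T = Δ^{|T|} applied to k ↦ 𝒴_{N−|T|+k}, where Δ = E − t₁.
module AvoidingSums {c ℓ : Level} (R : CommutativeRing c ℓ) (t : ℕ → Carrier R) where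
  open CommutativeRing R hiding (Carrier; zero)
    renaming (_+_ to _⊕_; _*_ to _⊗_; -_ to ⊖_)
  open import Relation.Binary.Reasoning.Setoid setoid
  open import Algebra.Properties.Ring ring using (x[y-z]≈xy-xz; [y-z]x≈yx-zx)
  open import Data.Fin.Subset using (Subset; ⊥; _∪_)
  open import Data.Fin.Subset.Properties using (∪-identityʳ)
  open import Data.Bool.Properties using (∧-comm; ∧-zeroʳ; ∧-identityʳ; not-involutive)
  open import Data.Fin using (toℕ)
  open import Data.Vec using ([]; _∷_; lookup)
  open import Data.Vec.Properties using (lookup-replicate)
  open import Data.List.Properties using (map-++; map-∘; map-cong)
  open import Data.List.Relation.Binary.Permutation.Propositional.Properties using (map⁺)
  open import Data.Product using (_,_)
  import Data.Nat.Properties as ℕ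
  open ListCounting
  open SubsetOps
  open RingSums R
  open FiniteDifference R using (Δ; Δ-cong)

  w : ∀ {n} → List (Subset n) → K
  w = weight R t

  avoidingTerm : ∀ {n} → Subset n → List (Subset n) → K
  avoidingTerm T π = 𝟙 (isSetPartition π) ⊗ (𝟙 (avoids T π) ⊗ w π)

  Avoiding : (N : ℕ) → Subset N → K
  Avoiding N T = ∑ (sublists (subsets N)) (avoidingTerm T)

  Avoiding-⊥ : ∀ N → Avoiding N ⊥ ≈ Y R t N
  Avoiding-⊥ N = trans (∑-cong (sublists (subsets N)) unrestricted)
                       (sym (∑-filter isSetPartition (sublists (subsets N)) w))
    where
    unrestricted : ∀ π → avoidingTerm ⊥ π ≈ 𝟙 (isSetPartition π) ⊗ w π
    unrestricted π = *-congˡ (trans (*-congʳ (reflexive (≡.cong 𝟙 (avoids-⊥ π)))) (*-identityˡ _))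

  weight-swap : ∀ {n} j (π : List (Subset n)) → w (map (swap j) π) ≡ w π
  weight-swap j π = ≡.cong (prodR R) (≡.trans (≡.sym (map-∘ π)) (map-cong (λ b → ≡.cong t (size-swap j b)) π))

  avoidingTerm-↭ : ∀ {n} (T : Subset n) {π π′ : List (Subset n)} → π ↭ π′ → avoidingTerm T π ≈ avoidingTerm T π′
  avoidingTerm-↭ T p = *-cong (reflexive (≡.cong 𝟙 (isSetPartition-↭ p)))
                              (*-cong (reflexive (≡.cong 𝟙 (all-↭ _ p))) (prodR-↭ (map⁺ (λ b → t (size b)) p)))

  -- transposing two points of T: relabel every partition accordingly
  Avoiding-swap : ∀ N (T : Subset N) j → Avoiding N T ≈ Avoiding N (swap j T)
  Avoiding-swap N T j = begin
    ∑ (sublists (subsets N)) (avoidingTerm T)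
      ≈⟨ ∑-sublists-↭ (avoidingTerm T) (avoidingTerm-↭ T) (subsets-swap j N) ⟨
    ∑ (sublists (map (swap j) (subsets N))) (avoidingTerm T)
      ≡⟨ ∑-sublists-map (swap j) (subsets N) (avoidingTerm T) ⟩
    ∑ (sublists (subsets N)) (λ π → avoidingTerm T (map (swap j) π))
      ≈⟨ ∑-cong (sublists (subsets N)) swapped ⟩
    ∑ (sublists (subsets N)) (avoidingTerm (swap j T)) ∎
    where
    swapped : ∀ π → avoidingTerm T (map (swap j) π) ≈ avoidingTerm (swap j T) π
    swapped π = reflexive (≡.cong₂ (λ a b → 𝟙 a ⊗ b) (isSetPartition-swap j π)
                  (≡.cong₂ (λ a b → 𝟙 a ⊗ b) (avoids-swap j T π) (weight-swap j π)))

  Avoiding-Swaps : ∀ {N} {T U : Subset N} → Swaps T U → Avoiding N T ≈ Avoiding N U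
  Avoiding-Swaps done               = refl
  Avoiding-Swaps {N} {T} (step j p) = trans (Avoiding-swap N T j) (Avoiding-Swaps p)

  first : ∀ N → Subset (suc N)
  first N = true ∷ ⊥

  firstSingletonTerm : ∀ {N} → Subset N → List (Subset (suc N)) → K
  firstSingletonTerm {N} T π =
    𝟙 (isSetPartition π) ⊗ (𝟙 (avoids (false ∷ T) π ∧ not (avoids (first N) π)) ⊗ w π)

  -- avoiding (true ∷ T) = avoiding (false ∷ T) and not having {0} as a block
  avoidingTerm-head : ∀ {N} (T : Subset N) π →
    avoidingTerm (true ∷ T) π ≈ avoidingTerm (false ∷ T) π - firstSingletonTerm T π
  avoidingTerm-head {N} T π = begin
    𝟙 i ⊗ (𝟙 (avoids (true ∷ T) π) ⊗ w π)    ≡⟨ ≡.cong (λ z → 𝟙 i ⊗ (𝟙 z ⊗ w π)) split ⟩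
    𝟙 i ⊗ (𝟙 (a ∧ not (not b)) ⊗ w π)        ≈⟨ *-congˡ (*-congʳ (𝟙-∧-not a (not b))) ⟩
    𝟙 i ⊗ ((𝟙 a - 𝟙 (a ∧ not b)) ⊗ w π)      ≈⟨ *-congˡ ([y-z]x≈yx-zx _ _ _) ⟩
    𝟙 i ⊗ (𝟙 a ⊗ w π - 𝟙 (a ∧ not b) ⊗ w π)  ≈⟨ x[y-z]≈xy-xz _ _ _ ⟩
    avoidingTerm (false ∷ T) π - firstSingletonTerm T π ∎
    where
    i = isSetPartition π
    a = avoids (false ∷ T) π
    b = avoids (first N) π
    -- true ∷ T = (false ∷ T) ∪ {0}
    split : avoids (true ∷ T) π ≡ a ∧ not (not b)
    split = ≡.trans (≡.cong (λ U → avoids (true ∷ U) π) (≡.sym (∪-identityʳ T)))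
            (≡.trans (avoids-∪ (false ∷ T) (first N) π) (≡.cong (a ∧_) (≡.sym (not-involutive b))))

  isSetPartition-head : ∀ {N} (π : List (Subset (suc N))) → isSetPartition π ≡
    all nonempty π ∧ ((count (λ b → lookup b zero) π ≡ᵇ 1) ∧
                      all (λ i → count (member (suc i)) π ≡ᵇ 1) (allFin N))
  isSetPartition-head π = ≡.cong (λ z → all nonempty π ∧ ((count (λ b → lookup b zero) π ≡ᵇ 1) ∧ z))
    (all-tabulate-cong (λ i → count (member i) π ≡ᵇ 1) (λ i → count (member (suc i)) π ≡ᵇ 1) suc id (λ i → ≡.refl))

  -- a family of subsets of [N+1] is a family F of blocks without 0
  -- together with a family G of blocks containing 0
  count-first : ∀ {N} (F G : List (Subset N)) →
    count (λ b → lookup b zero) (map (false ∷_) F ++ map (true ∷_) G) ≡ length G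
  count-first F G = ≡.trans (count-++ _ (map (false ∷_) F) (map (true ∷_) G))
    (≡.cong₂ _+_ (≡.trans (count-map _ (false ∷_) F) (count-none _ F (λ _ → ≡.refl)))
                 (≡.trans (count-map _ (true ∷_) G) (count-all _ G (λ _ → ≡.refl))))

  firstSingletonTerm-one-block : ∀ {N} (T : Subset N) (F G : List (Subset N)) → (length G ≡ᵇ 1) ≡ false →
    firstSingletonTerm T (map (false ∷_) F ++ map (true ∷_) G) ≈ 0#
  firstSingletonTerm-one-block T F G e = trans (*-congʳ (reflexive (≡.cong 𝟙 notPartition))) (zeroˡ _)
    where
    π = map (false ∷_) F ++ map (true ∷_) G
    rest = all (λ i → count (member (suc i)) π ≡ᵇ 1) (allFin _)
    notPartition : isSetPartition π ≡ false
    notPartition = ≡.trans (isSetPartition-head π)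
      (≡.trans (≡.cong (λ z → all nonempty π ∧ ((z ≡ᵇ 1) ∧ rest)) (count-first F G))
               (≡.trans (≡.cong (λ z → all nonempty π ∧ (z ∧ rest)) e) (∧-zeroʳ _)))

  adjoin : ∀ {N} → List (Subset N) → Subset N → List (Subset (suc N))
  adjoin F b = map (false ∷_) F ++ [ true ∷ b ]

  avoids-first : ∀ {N} (F : List (Subset N)) (b : Subset N) →
    avoids (first N) (adjoin F b) ≡ not (size b ≡ᵇ 0)
  avoids-first F b = ≡.trans (all-++ _ (map (false ∷_) F) [ true ∷ b ])
    (≡.trans (≡.cong (_∧ (not ((size b ≡ᵇ 0) ∧ true) ∧ true))
                     (≡.trans (all-map _ (false ∷_) F) (avoids-⊥ F)))
             (≡.trans (∧-identityʳ _) (≡.cong not (∧-identityʳ _))))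

  ∑-subsets-⊥ : ∀ N (f : Subset N → K) → ∑ (subsets N) (λ b → 𝟙 (size b ≡ᵇ 0) ⊗ f b) ≈ f ⊥
  ∑-subsets-⊥ zero    f = trans (+-identityʳ _) (*-identityˡ _)
  ∑-subsets-⊥ (suc N) f = begin
    ∑ (map (false ∷_) (subsets N) ++ map (true ∷_) (subsets N)) g
      ≈⟨ ∑-++ (map (false ∷_) (subsets N)) (map (true ∷_) (subsets N)) g ⟩
    ∑ (map (false ∷_) (subsets N)) g ⊕ ∑ (map (true ∷_) (subsets N)) g
      ≡⟨ ≡.cong₂ _⊕_ (∑-map (false ∷_) (subsets N) g) (∑-map (true ∷_) (subsets N) g) ⟩
    ∑ (subsets N) (g ∘ (false ∷_)) ⊕ ∑ (subsets N) (g ∘ (true ∷_))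
      ≈⟨ +-cong (∑-subsets-⊥ N (f ∘ (false ∷_))) (∑-zero (subsets N) _ (λ b → zeroˡ _)) ⟩
    f ⊥ ⊕ 0#  ≈⟨ +-identityʳ _ ⟩
    f ⊥       ∎
    where
    g = λ b → 𝟙 (size b ≡ᵇ 0) ⊗ f b

  firstSingletonTerm-empty : ∀ {N} (T : Subset N) F b →
    firstSingletonTerm T (adjoin F b) ≈ 𝟙 (size b ≡ᵇ 0) ⊗ firstSingletonTerm T (adjoin F b)
  firstSingletonTerm-empty {N} T F b with size b ≡ᵇ 0 in eq
  ... | true  = sym (*-identityˡ _)
  ... | false = trans (trans (*-congˡ (trans (*-congʳ (reflexive (≡.cong 𝟙 noSingleton))) (zeroˡ _))) (zeroʳ _))
                      (sym (zeroˡ _))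
    where
    noSingleton : avoids (false ∷ T) (adjoin F b) ∧ not (avoids (first N) (adjoin F b)) ≡ false
    noSingleton = ≡.trans (≡.cong (λ z → avoids (false ∷ T) (adjoin F b) ∧ not z)
                                  (≡.trans (avoids-first F b) (≡.cong not eq)))
                          (∧-zeroʳ _)

  isSetPartition-adjoin : ∀ {N} (F : List (Subset N)) → isSetPartition (adjoin F ⊥) ≡ isSetPartition F
  isSetPartition-adjoin {N} F = ≡.trans (isSetPartition-head π) (≡.cong₂ _∧_
      (≡.trans (all-++ nonempty (map (false ∷_) F) [ true ∷ ⊥ ])
               (≡.trans (≡.cong (_∧ true) (all-map nonempty (false ∷_) F)) (∧-identityʳ _)))
      (≡.trans (≡.cong (λ z → (z ≡ᵇ 1) ∧ all (λ i → count (member (suc i)) π ≡ᵇ 1) (allFin N)) (count-first F [ ⊥ ]))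
               (all-cong (allFin N) (λ i → ≡.cong (_≡ᵇ 1) (count-shifted i)))))
    where
    π = adjoin F ⊥
    not-in-⊥ : ∀ i → count (member (suc i)) [ true ∷ ⊥ ] ≡ 0
    not-in-⊥ i rewrite lookup-replicate i false = ≡.refl
    count-shifted : ∀ i → count (member (suc i)) π ≡ count (member i) F
    count-shifted i = ≡.trans (count-++ (member (suc i)) (map (false ∷_) F) [ true ∷ ⊥ ])
      (≡.trans (≡.cong₂ _+_ (count-map (member (suc i)) (false ∷_) F) (not-in-⊥ i)) (ℕ.+-identityʳ _))

  avoids-adjoin : ∀ {N} (T : Subset N) (F : List (Subset N)) → avoids (false ∷ T) (adjoin F ⊥) ≡ avoids T F
  avoids-adjoin {N} T F = ≡.trans (all-++ _ (map (false ∷_) F) [ true ∷ ⊥ ])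
    (≡.trans (≡.cong₂ _∧_ (all-map _ (false ∷_) F)
                          (≡.cong (λ z → not ((size (⊥ {N}) ≡ᵇ 0) ∧ z) ∧ true) (meets-⊥ˡ T)))
             (≡.trans (≡.cong (λ z → avoids T F ∧ (not z ∧ true)) (∧-zeroʳ _)) (∧-identityʳ _)))

  weight-adjoin : ∀ {N} (F : List (Subset N)) → w (adjoin F ⊥) ≈ w F ⊗ t 1
  weight-adjoin {N} F = begin
    prodR R (map ts (map (false ∷_) F ++ [ true ∷ ⊥ ]))
      ≡⟨ ≡.cong (prodR R) (map-++ ts (map (false ∷_) F) [ true ∷ ⊥ ]) ⟩
    prodR R (map ts (map (false ∷_) F) ++ [ t (suc (size (⊥ {N}))) ])
      ≈⟨ prodR-++ (map ts (map (false ∷_) F)) _ ⟩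
    prodR R (map ts (map (false ∷_) F)) ⊗ (t (suc (size (⊥ {N}))) ⊗ 1#)
      ≡⟨ ≡.cong₂ (λ u v → prodR R u ⊗ (t (suc v) ⊗ 1#)) (≡.sym (map-∘ F)) (size-⊥ N) ⟩
    w F ⊗ (t 1 ⊗ 1#) ≈⟨ *-congˡ (*-identityʳ _) ⟩
    w F ⊗ t 1 ∎
    where
    ts = λ (b : Subset (suc N)) → t (size b)

  firstSingletonTerm-adjoin : ∀ {N} (T : Subset N) F → firstSingletonTerm T (adjoin F ⊥) ≈ t 1 ⊗ avoidingTerm T F
  firstSingletonTerm-adjoin {N} T F = begin
    𝟙 (isSetPartition π) ⊗ (𝟙 (avoids (false ∷ T) π ∧ not (avoids (first N) π)) ⊗ w π)
      ≡⟨ ≡.cong₂ (λ u v → 𝟙 u ⊗ (𝟙 v ⊗ w π)) (isSetPartition-adjoin F)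
           (≡.cong₂ (λ u v → u ∧ not v) (avoids-adjoin T F)
                    (≡.trans (avoids-first F ⊥) (≡.cong (λ z → not (z ≡ᵇ 0)) (size-⊥ N)))) ⟩
    𝟙 (isSetPartition F) ⊗ (𝟙 (avoids T F ∧ true) ⊗ w π)
      ≈⟨ *-congˡ (*-cong (reflexive (≡.cong 𝟙 (∧-identityʳ (avoids T F)))) (weight-adjoin F)) ⟩
    𝟙 (isSetPartition F) ⊗ (𝟙 (avoids T F) ⊗ (w F ⊗ t 1))
      ≈⟨ *-congˡ (*-assoc _ _ _) ⟨
    𝟙 (isSetPartition F) ⊗ ((𝟙 (avoids T F) ⊗ w F) ⊗ t 1)
      ≈⟨ *-assoc _ _ _ ⟨
    (𝟙 (isSetPartition F) ⊗ (𝟙 (avoids T F) ⊗ w F)) ⊗ t 1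
      ≈⟨ *-comm _ _ ⟩
    t 1 ⊗ avoidingTerm T F ∎
    where
    π = adjoin F ⊥

  -- partitions of [N+1] avoiding T shifted by one with {0} as a block are
  -- {0} adjoined to a partition of [N] avoiding T
  ∑-firstSingletonTerm : ∀ {N} (T : Subset N) →
    ∑ (sublists (subsets (suc N))) (firstSingletonTerm T) ≈ t 1 ⊗ Avoiding N T
  ∑-firstSingletonTerm {N} T = begin
    ∑ (sublists (map (false ∷_) S ++ map (true ∷_) S)) (firstSingletonTerm T)
      ≈⟨ ∑-sublists-++ (map (false ∷_) S) (map (true ∷_) S) (firstSingletonTerm T) ⟩
    ∑ (sublists (map (false ∷_) S)) (λ F → ∑ (sublists (map (true ∷_) S)) (λ G → firstSingletonTerm T (F ++ G)))
      ≡⟨ ∑-sublists-map (false ∷_) S _ ⟩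
    ∑ (sublists S) (λ F → ∑ (sublists (map (true ∷_) S)) (λ G → firstSingletonTerm T (map (false ∷_) F ++ G)))
      ≈⟨ ∑-cong (sublists S) (λ F → reflexive (∑-sublists-map (true ∷_) S _)) ⟩
    ∑ (sublists S) (λ F → ∑ (sublists S) (λ G → firstSingletonTerm T (map (false ∷_) F ++ map (true ∷_) G)))
      ≈⟨ ∑-cong (sublists S) (λ F → ∑-sublists-singletons S _ (firstSingletonTerm-one-block T F)) ⟩
    ∑ (sublists S) (λ F → ∑ S (λ b → firstSingletonTerm T (adjoin F b)))
      ≈⟨ ∑-cong (sublists S) (λ F → trans (∑-cong S (firstSingletonTerm-empty T F)) (∑-subsets-⊥ N _)) ⟩
    ∑ (sublists S) (λ F → firstSingletonTerm T (adjoin F ⊥))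
      ≈⟨ ∑-cong (sublists S) (firstSingletonTerm-adjoin T) ⟩
    ∑ (sublists S) (λ F → t 1 ⊗ avoidingTerm T F)
      ≈⟨ ∑-*ˡ (sublists S) (t 1) (avoidingTerm T) ⟩
    t 1 ⊗ Avoiding N T ∎
    where
    S = subsets N

  Avoiding-head : ∀ {N} (T : Subset N) →
    Avoiding (suc N) (true ∷ T) ≈ Avoiding (suc N) (false ∷ T) - t 1 ⊗ Avoiding N T
  Avoiding-head {N} T = begin
    Avoiding (suc N) (true ∷ T)
      ≈⟨ ∑-cong families (avoidingTerm-head T) ⟩
    ∑ families (λ π → avoidingTerm (false ∷ T) π - firstSingletonTerm T π)
      ≈⟨ ∑-- families _ _ ⟩
    Avoiding (suc N) (false ∷ T) - ∑ families (firstSingletonTerm T)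
      ≈⟨ +-congˡ (-‿cong (∑-firstSingletonTerm T)) ⟩
    Avoiding (suc N) (false ∷ T) - t 1 ⊗ Avoiding N T ∎
    where
    families = sublists (subsets (suc N))

  -- (i)–(iii) together, by induction on s = |T|: Avoiding N T = (Δˢ G)(0)
  -- for G(k) = 𝒴_{N−s+k}; the inductive step first moves a point of T to 0
  Avoiding-by-size : ∀ s N (T : Subset N) → size T ≡ s →
                     Avoiding N T ≈ Δ (t 1) s (λ k → Y R t (N ∸ s + k))
  Avoiding-by-size zero N T e =
    trans (reflexive (≡.cong (Avoiding N) (size≡0⇒⊥ T e)))
          (trans (Avoiding-⊥ N) (reflexive (≡.cong (Y R t) (≡.sym (ℕ.+-identityʳ N)))))
  Avoiding-by-size (suc s) zero    [] ()
  Avoiding-by-size (suc s) (suc N) T e with bubble T s e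
  ... | T₀ , e₀ , T↝true∷T₀ = begin
    Avoiding (suc N) T                              ≈⟨ Avoiding-Swaps T↝true∷T₀ ⟩
    Avoiding (suc N) (true ∷ T₀)                    ≈⟨ Avoiding-head T₀ ⟩
    Avoiding (suc N) (false ∷ T₀) - t 1 ⊗ Avoiding N T₀
      ≈⟨ +-cong (Avoiding-by-size s (suc N) (false ∷ T₀) e₀) (-‿cong (*-congˡ (Avoiding-by-size s N T₀ e₀))) ⟩
    Δ (t 1) s (λ k → Y R t (suc N ∸ s + k)) - t 1 ⊗ Δ (t 1) s (λ k → Y R t (N ∸ s + k))
      ≈⟨ +-congʳ (Δ-cong (t 1) s (λ k → reflexive (≡.cong (Y R t) (reindex k)))) ⟩
    Δ (t 1) (suc s) (λ k → Y R t (suc N ∸ suc s + k)) ∎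
    where
    reindex : ∀ k → suc N ∸ s + k ≡ N ∸ s + suc k
    reindex k = ≡.trans (≡.cong (_+ k) (ℕ.+-∸-assoc 1 (≡.subst (_≤ N) e₀ (size≤ T₀))))
                        (≡.sym (ℕ.+-suc (N ∸ s) k))

  -- The largest singleton block is {m} exactly when the partition has no
  -- singleton block above m, but does have one in {m, m+1, …}.
  noLargerSingleton-as-avoids : ∀ m L (π : List (Subset L)) →
    noLargerSingleton m π ≡ avoids (above (suc m) L) π
  noLargerSingleton-as-avoids m L π = all-cong π block
    where
    noneAbove : Subset L → Bool
    noneAbove b = all (λ i → not (member i b) ∨ (toℕ i ≤ᵇ m)) (allFin L)
    implication : ∀ a c → not (a ∧ not c) ≡ not a ∨ c
    implication true  c = not-involutive c
    implication false c = ≡.refl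
    block : ∀ b → (not (size b ≡ᵇ 1) ∨ noneAbove b) ≡ not (singletonIn (above (suc m) L) b)
    block b = ≡.trans (≡.sym (implication (size b ≡ᵇ 1) (noneAbove b)))
      (≡.cong (λ z → not ((size b ≡ᵇ 1) ∧ z)) (≡.sym (≡.trans (meets-as-all b (above (suc m) L))
        (≡.cong not (all-cong (allFin L) (λ i → ≡.trans (≡.cong (λ z → not (lookup b i ∧ z)) (lookup-above m L i))
                                                         (implication (lookup b i) (toℕ i ≤ᵇ m))))))))

  hasSingleton-as-avoids : ∀ m L (π : List (Subset L)) → hasSingleton m π ≡ not (avoids (single m L) π)
  hasSingleton-as-avoids m L π = ≡.trans (any-as-all _ π) (≡.cong not (all-cong π (λ b →
    ≡.cong (λ z → not ((size b ≡ᵇ 1) ∧ z)) (≡.trans (any-as-all (λ i → member i b ∧ (toℕ i ≡ᵇ m)) (allFin L))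
      (≡.sym (≡.trans (meets-as-all b (single m L))
        (≡.cong not (all-cong (allFin L) (λ i → ≡.cong (λ z → not (lookup b i ∧ z)) (lookup-single m L i))))))))))

  A-as-difference : ∀ n m →
    A R t n m ≈ Avoiding (suc n) (above (suc m) (suc n)) - Avoiding (suc n) (above m (suc n))
  A-as-difference n m = begin
    ∑ (filterᵇ (largestSingletonIs m) (filterᵇ isSetPartition families)) w
      ≈⟨ ∑-filter (largestSingletonIs m) (filterᵇ isSetPartition families) w ⟩
    ∑ (filterᵇ isSetPartition families) (λ π → 𝟙 (largestSingletonIs m π) ⊗ w π)
      ≈⟨ ∑-filter isSetPartition families _ ⟩
    ∑ families (λ π → 𝟙 (isSetPartition π) ⊗ (𝟙 (largestSingletonIs m π) ⊗ w π))
      ≈⟨ ∑-cong families difference ⟩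
    ∑ families (λ π → avoidingTerm (above (suc m) L) π - avoidingTerm (above m L) π)
      ≈⟨ ∑-- families _ _ ⟩
    Avoiding L (above (suc m) L) - Avoiding L (above m L) ∎
    where
    L = suc n
    families = sublists (subsets L)
    difference : ∀ π → 𝟙 (isSetPartition π) ⊗ (𝟙 (largestSingletonIs m π) ⊗ w π) ≈
                       avoidingTerm (above (suc m) L) π - avoidingTerm (above m L) π
    difference π = begin
      𝟙 i ⊗ (𝟙 (hasSingleton m π ∧ noLargerSingleton m π) ⊗ w π)
        ≡⟨ ≡.cong₂ (λ u v → 𝟙 i ⊗ (𝟙 (u ∧ v) ⊗ w π)) (hasSingleton-as-avoids m L π) (noLargerSingleton-as-avoids m L π) ⟩
      𝟙 i ⊗ (𝟙 (not b ∧ a) ⊗ w π)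
        ≡⟨ ≡.cong (λ z → 𝟙 i ⊗ (𝟙 z ⊗ w π)) (∧-comm (not b) a) ⟩
      𝟙 i ⊗ (𝟙 (a ∧ not b) ⊗ w π)
        ≈⟨ *-congˡ (*-congʳ (𝟙-∧-not a b)) ⟩
      𝟙 i ⊗ ((𝟙 a - 𝟙 (a ∧ b)) ⊗ w π)
        ≈⟨ trans (*-congˡ ([y-z]x≈yx-zx _ _ _)) (x[y-z]≈xy-xz _ _ _) ⟩
      avoidingTerm (above (suc m) L) π - 𝟙 i ⊗ (𝟙 (a ∧ b) ⊗ w π)
        ≡⟨ ≡.cong (λ z → avoidingTerm (above (suc m) L) π - 𝟙 i ⊗ (𝟙 z ⊗ w π))
                  (≡.sym (≡.trans (≡.cong (λ U → avoids U π) (above-split m L)) (avoids-∪ _ _ π))) ⟩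
      avoidingTerm (above (suc m) L) π - avoidingTerm (above m L) π ∎
      where
      i = isSetPartition π
      a = avoids (above (suc m) L) π
      b = avoids (single m L) π

  A-via-Δ : ∀ n m → A R t (n + m) m ≈
    Δ (t 1) n (λ k → Y R t (m + suc k)) - Δ (t 1) (suc n) (λ k → Y R t (m + k))
  A-via-Δ n m = begin
    A R t (n + m) m
      ≈⟨ A-as-difference (n + m) m ⟩
    Avoiding L (above (suc m) L) - Avoiding L (above m L)
      ≈⟨ +-cong (Avoiding-by-size n L _ (≡.trans (size-above (suc m) L) (ℕ.m+n∸n≡m n m)))
                (-‿cong (Avoiding-by-size (suc n) L _ (≡.trans (size-above m L) L∸m))) ⟩
    Δ (t 1) n (λ k → Y R t (L ∸ n + k)) - Δ (t 1) (suc n) (λ k → Y R t (L ∸ suc n + k))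
      ≈⟨ +-cong (Δ-cong (t 1) n (λ k → reflexive (≡.cong (Y R t) (L∸n+k k))))
                (-‿cong (Δ-cong (t 1) (suc n) (λ k → reflexive (≡.cong (Y R t) (≡.cong (_+ k) (ℕ.m+n∸m≡n n m)))))) ⟩
    Δ (t 1) n (λ k → Y R t (m + suc k)) - Δ (t 1) (suc n) (λ k → Y R t (m + k)) ∎
    where
    L = suc (n + m)
    L∸m : L ∸ m ≡ suc n
    L∸m = ≡.trans (ℕ.+-∸-assoc 1 (ℕ.m≤n+m m n)) (≡.cong suc (ℕ.m+n∸n≡m n m))
    L∸n+k : ∀ k → L ∸ n + k ≡ m + suc k
    L∸n+k k = ≡.trans (≡.cong (_+ k) (≡.trans (ℕ.+-∸-assoc 1 (ℕ.m≤m+n n m)) (≡.cong suc (ℕ.m+n∸m≡n n m))))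
                      (≡.sym (ℕ.+-suc m k))

corollary2p3 : ∀ {c ℓ : Level} (R : CommutativeRing c ℓ) →
    (t : ℕ → Carrier R) (n m : ℕ) →
    R ⊢ A R t (n + m) m ≈
      sumUpTo R n (λ k → R ⊢ (R ⊢ (R ⊢ signR R (n ∸ k) * natR R (n C k))
                                  * powR R (t 1) (n ∸ k + 1))
                             * Y R t (m + k))
corollary2p3 R t n m = begin
  A R t (n + m) m                          ≈⟨ A-via-Δ n m ⟩
  Δ x n (G ∘ suc) - Δ x (suc n) G          ≈⟨ Δ-shift-difference x n G ⟩
  x ⊗ Δ x n G                              ≈⟨ *-congˡ (Δ-expansion x n G) ⟩
  x ⊗ sumUpTo R n (term x n G)             ≈⟨ sumUpTo-*ˡ n x (term x n G) ⟨
  sumUpTo R n (λ k → x ⊗ term x n G k)     ≈⟨ sumUpTo-cong n (λ k _ → *-term x n G k) ⟩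
  sumUpTo R n (λ k → ((signR R (n ∸ k) ⊗ natR R (n C k)) ⊗ powR R x (n ∸ k + 1)) ⊗ G k) ∎
  where
  open CommutativeRing R using (setoid; *-congˡ; _-_) renaming (_*_ to _⊗_)
  open import Relation.Binary.Reasoning.Setoid setoid
  open RingSums R using (sumUpTo-cong; sumUpTo-*ˡ)
  open FiniteDifference R using (Δ; Δ-shift-difference; Δ-expansion; term; *-term)
  open AvoidingSums R t using (A-via-Δ)
  x = t 1
  G = λ k → Y R t (m + k)
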